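{- Let $k\ge0$ be an integer and $w\in\Sigma^{2k}\setminus\Sigma^*11\Sigma^*$ (a binary word of length $2k$ with no two consecutive $1$'s). Then: (1) $\operatorname{val}_\mathcal{F}(0w)=\operatorname{val}_\mathcal{F}(000w)=\operatorname{val}_\mathcal{F}(110w)$; (2) $\operatorname{val}_\mathcal{F}(1w)=\operatorname{val}_\mathcal{F}(101w)$; (3) $\operatorname{val}_\mathcal{F}(100w)=\operatorname{val}_\mathcal{F}(000w)-F_{2k+2}$; (4) $0\le\operatorname{val}_\mathcal{F}(0w)<F_{2k+1}$; (5) $-F_{2k+2}\le\operatorname{val}_\mathcal{F}(100w)<0$.
   Context: $\Sigma=\{0,1\}$. Fibonacci numbers: $F_0=1$, $F_1=1$, $F_{n+2}=F_{n+1}+F_n$ for $n\ge0$. For any odd-length binary word $u=u_{2j+1}u_{2j}\cdots u_1$ (digits indexed from right to left, $j\ge0$), $\operatorname{val}_\mathcal{F}(u)=\sum_{i=1}^{2j}u_iF_i-u_{2j+1}F_{2j}$. -}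

module Defs where

open import Data.Nat using (ℕ; zero; suc; _+_)
open import Data.Bool using (Bool; true; false; if_then_else_)
open import Data.List using (List; []; _∷_; length)
open import Data.Integer using (ℤ; +_; _-_)
open import Data.Empty using (⊥)
open import Data.Unit using (⊤)

F : ℕ → ℕ
F zero = 1
F (suc zero) = 1
F (suc (suc n)) = F (suc n) + F n

-- Binary words as lists of digits, written left to right as in the paper:
-- the head is the most significant digit u_{len}, the last element is u_1.
Word : Set
Word = List Bool

digit : Bool → ℕ
digit true = 1
digit false = 0

posVal : Word → ℕ
posVal [] = 0
posVal (b ∷ bs) = digit b Data.Nat.* F (suc (length bs)) + posVal bs

-- val_F(u) for u = u_{2j+1} u_{2j} ... u_1 (odd length):
--   Σ_{i=1}^{2j} u_i F_i - u_{2j+1} F_{2j}.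
-- (Only applied to odd-length words; the value on [] is irrelevant.)
valF : Word → ℤ
valF [] = + 0
valF (b ∷ bs) = + posVal bs - + (digit b Data.Nat.* F (length bs))

No11 : Word → Set
No11 [] = ⊤
No11 (true ∷ true ∷ _) = ⊥
No11 (_ ∷ bs) = No11 bs

-- Reading val_F(u) as (value of the last 2j digits) - u_{2j+1} F_{2j}, each identity
-- reduces to F_{n+2} = F_{n+1} + F_n, where n is the length of w.  The bounds rest on the
-- Zeckendorf estimate: a word of length n without factor 11 has posVal below F_{n+1}.
module Submission where

open import Defs
open import Data.Nat using (ℕ; suc; _*_)
open import Data.Bool using (true; false)
open import Data.List using ([]; _∷_; length)
open import Data.Integer using (+_; -_; _-_; _≤_; _<_)
open import Data.Product using (_×_; _,_)
open import Relation.Binary.PropositionalEquality using (_≡_; refl; sym; cong; subst; module ≡-Reasoning)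

open import Data.Nat as ℕ using (_+_; z≤n; s≤s)
open import Data.Nat.Properties using (m≤m+n; +-identityʳ; *-identityˡ; <-≤-trans; +-monoʳ-<)
open import Data.Integer as ℤ using (_⊖_; 0ℤ)
open import Data.Integer.Properties
  using ([+m]-[+n]≡m⊖n; +-cancelˡ-⊖; ⊖-swap; n⊖n≡0; ⊖-monoˡ-≤; ⊖-monoˡ-<)

F-≤-F-suc : ∀ n → F n ℕ.≤ F (suc n)
F-≤-F-suc 0       = s≤s z≤n
F-≤-F-suc (suc n) = m≤m+n (F (suc n)) (F n)

No11-tail : ∀ b bs → No11 (b ∷ bs) → No11 bs
No11-tail false []           _  = _
No11-tail false (_ ∷ _)      h  = h
No11-tail true  []           _  = _
No11-tail true  (false ∷ _)  h  = h
No11-tail true  (true ∷ _)   ()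

posVal<F : ∀ w → No11 w → posVal w ℕ.< F (suc (length w))
posVal<F []                  _ = s≤s z≤n
posVal<F (false ∷ w)         h =
  <-≤-trans (posVal<F w (No11-tail false w h)) (F-≤-F-suc (suc (length w)))
posVal<F (true ∷ [])         _ = s≤s (s≤s z≤n)
posVal<F (true ∷ true ∷ _)   ()
posVal<F (true ∷ false ∷ w)  h
  rewrite +-identityʳ (F (suc (suc (length w)))) =
  +-monoʳ-< (F (suc (suc (length w)))) (posVal<F w h)

posVal-true : ∀ w → posVal (true ∷ w) ≡ F (suc (length w)) + posVal w
posVal-true w = cong (_+ posVal w) (*-identityˡ (F (suc (length w))))

valF-false : ∀ w → valF (false ∷ w) ≡ + posVal w
valF-false w = [+m]-[+n]≡m⊖n (posVal w) 0

valF-true : ∀ w → valF (true ∷ w) ≡ posVal w ⊖ F (length w)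
valF-true w rewrite *-identityˡ (F (length w)) = [+m]-[+n]≡m⊖n (posVal w) (F (length w))

valF-true≡valF-false-F : ∀ w → valF (true ∷ w) ≡ valF (false ∷ w) - + F (length w)
valF-true≡valF-false-F w rewrite *-identityˡ (F (length w)) =
  cong (_- + F (length w)) (sym (valF-false w))

⊖-bounds : ∀ {m n} → m ℕ.< n → - + n ≤ m ⊖ n × m ⊖ n < 0ℤ
⊖-bounds {m} {n} m<n =
  subst (_≤ m ⊖ n) (⊖-swap 0 n) (⊖-monoˡ-≤ n z≤n) ,
  subst (m ⊖ n <_) (n⊖n≡0 n) (⊖-monoˡ-< n m<n)

module _ (w : Word) where
  open ≡-Reasoning

  private
    n : ℕ
    n = length w

  valF-000≡valF-110 : valF (false ∷ false ∷ false ∷ w) ≡ valF (true ∷ true ∷ false ∷ w)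
  valF-000≡valF-110 = begin
    valF (false ∷ false ∷ false ∷ w)          ≡⟨ valF-false (false ∷ false ∷ w) ⟩
    posVal w ⊖ 0                              ≡⟨ sym (+-cancelˡ-⊖ (F (suc (suc n))) (posVal w) 0) ⟩
    (F (suc (suc n)) + posVal w) ⊖ (F (suc (suc n)) + 0)
      ≡⟨ cong ((F (suc (suc n)) + posVal w) ⊖_) (+-identityʳ (F (suc (suc n)))) ⟩
    (F (suc (suc n)) + posVal w) ⊖ F (suc (suc n))
      ≡⟨ cong (_⊖ F (suc (suc n))) (sym (posVal-true (false ∷ w))) ⟩
    posVal (true ∷ false ∷ w) ⊖ F (suc (suc n)) ≡⟨ sym (valF-true (true ∷ false ∷ w)) ⟩
    valF (true ∷ true ∷ false ∷ w)            ∎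

  valF-1≡valF-101 : valF (true ∷ w) ≡ valF (true ∷ false ∷ true ∷ w)
  valF-1≡valF-101 = begin
    valF (true ∷ w)                           ≡⟨ valF-true w ⟩
    posVal w ⊖ F n                            ≡⟨ sym (+-cancelˡ-⊖ (F (suc n)) (posVal w) (F n)) ⟩
    (F (suc n) + posVal w) ⊖ F (suc (suc n))  ≡⟨ cong (_⊖ F (suc (suc n))) (sym (posVal-true w)) ⟩
    posVal (true ∷ w) ⊖ F (suc (suc n))       ≡⟨ sym (valF-true (false ∷ true ∷ w)) ⟩
    valF (true ∷ false ∷ true ∷ w)            ∎

  valF-0-bounds : No11 w → + 0 ≤ valF (false ∷ w) × valF (false ∷ w) < + F (suc n)
  valF-0-bounds h rewrite valF-false w = ℤ.+≤+ z≤n , ℤ.+<+ (posVal<F w h)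

  valF-100-bounds : No11 w →
    - + F (suc (suc n)) ≤ valF (true ∷ false ∷ false ∷ w) × valF (true ∷ false ∷ false ∷ w) < + 0
  valF-100-bounds h rewrite valF-true (false ∷ false ∷ w) =
    ⊖-bounds (<-≤-trans (posVal<F w h) (F-≤-F-suc (suc n)))

lemma1 : (k : ℕ) (w : Word) → length w ≡ 2 * k → No11 w →
    (valF (false ∷ w) ≡ valF (false ∷ false ∷ false ∷ w)
      × valF (false ∷ false ∷ false ∷ w) ≡ valF (true ∷ true ∷ false ∷ w))
    × valF (true ∷ w) ≡ valF (true ∷ false ∷ true ∷ w)
    × valF (true ∷ false ∷ false ∷ w) ≡ valF (false ∷ false ∷ false ∷ w) - + F (suc (suc (2 * k)))
    × (+ 0 ≤ valF (false ∷ w) × valF (false ∷ w) < + F (suc (2 * k)))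
    × (- + F (suc (suc (2 * k))) ≤ valF (true ∷ false ∷ false ∷ w) × valF (true ∷ false ∷ false ∷ w) < + 0)
lemma1 k w |w|≡2k no11 rewrite sym |w|≡2k =
  (refl , valF-000≡valF-110 w) ,
  valF-1≡valF-101 w ,
  valF-true≡valF-false-F (false ∷ false ∷ w) ,
  valF-0-bounds w no11 ,
  valF-100-bounds w no11
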